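{- Let $P$ and $Q$ be finite subsets of $\mathbb{R}^d/\mathbb{R}\mathbf{1}$ and let $i_P,i_Q,j\in\{1,\dots,d\}$ be pairwise distinct. Consider index maps with $i(p)=i_P$ for all $p\in P$, $i(q)=i_Q$ for all $q\in Q$, and $j(\xi)=j$ for all $\xi\in P\cup Q$. Then the hard margin linear program has a feasible solution if and only if $$\max_{q\in Q}\{q_{i_P}-q_j\}\le\min_{p\in P}\{p_{i_P}-p_j\}\quad\text{and}\quad\max_{p\in P}\{p_{i_Q}-p_j\}\le\min_{q\in Q}\{q_{i_Q}-q_j\}.$$ If a feasible solution exists, the optimal value of $z$ is $$\min\Big\{\min_{p\in P}\{p_{i_P}-p_j\}+\min_{q\in Q}\{q_j-q_{i_P}\},\ \min_{q\in Q}\{q_{i_Q}-q_j\}+\min_{p\in P}\{p_j-p_{i_Q}\}\Big\}.$$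
   Context: $\mathbb{R}^d/\mathbb{R}\mathbf{1}$ is the tropical projective torus ($\mathbb{R}^d$ modulo adding multiples of $(1,\dots,1)$). Given index maps $i,j:P\cup Q\to\{1,\dots,d\}$, the hard margin linear program is: maximize $z$ over $(z;\omega)\in\mathbb{R}^{d+1}$ subject to, for all $\xi\in P\cup Q$: $z+\xi_{j(\xi)}+\omega_{j(\xi)}-\xi_{i(\xi)}-\omega_{i(\xi)}\le 0$; $\omega_{j(\xi)}-\omega_{i(\xi)}\le\xi_{i(\xi)}-\xi_{j(\xi)}$; and $\omega_l-\omega_{j(\xi)}\le\xi_{j(\xi)}-\xi_l$ for all $l\ne i(\xi),j(\xi)$. The optimal value is the maximum of $z$ over feasible solutions. -}

module Defs where

open import Level using (Level; _⊔_) renaming (suc to lsuc)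
open import Data.Empty using (⊥)
open import Data.Sum using (_⊎_; inj₁; inj₂)
open import Data.Product using (_×_; Σ; Σ-syntax)
open import Data.Fin using (Fin)
open import Data.List.NonEmpty using (List⁺; _∷_; foldr₁; map; toList)
open import Data.Nat using (ℕ)
open import Data.List.Membership.Propositional using (_∈_)
open import Relation.Nullary using (¬_)
open import Relation.Binary.PropositionalEquality using (_≡_)
open import Relation.Binary.Structures using (IsTotalOrder)
open import Algebra.Structures using (IsCommutativeRing)

_∈⁺_ : ∀ {a} {A : Set a} → A → List⁺ A → Set a
x ∈⁺ xs = x ∈ toList xs

record OrderedField (c : Level) : Set (lsuc c) where
  infixl 6 _+_ _-_
  infixl 7 _*_
  infix 4 _≤_
  field
    Carrier : Set c
    _+_ _*_ : Carrier → Carrier → Carrier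
    -_      : Carrier → Carrier
    0# 1#   : Carrier
    _≤_     : Carrier → Carrier → Set c
    isCommutativeRing : IsCommutativeRing _≡_ _+_ _*_ -_ 0# 1#
    0≢1     : ¬ (0# ≡ 1#)
    _⁻¹     : (x : Carrier) → ¬ (x ≡ 0#) → Carrier
    ⁻¹-inverse : (x : Carrier) (x≢0 : ¬ (x ≡ 0#)) → x * _⁻¹ x x≢0 ≡ 1#
    isTotalOrder : IsTotalOrder _≡_ _≤_
    +-mono-≤ : ∀ {x y} z → x ≤ y → x + z ≤ y + z
    *-nonneg : ∀ {x y} → 0# ≤ x → 0# ≤ y → 0# ≤ x * y

  _-_ : Carrier → Carrier → Carrier
  x - y = x + (- y)

  min : Carrier → Carrier → Carrier
  min x y with IsTotalOrder.total isTotalOrder x y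
  ... | inj₁ _ = x
  ... | inj₂ _ = y

  max : Carrier → Carrier → Carrier
  max x y with IsTotalOrder.total isTotalOrder x y
  ... | inj₁ _ = y
  ... | inj₂ _ = x

  minOver : {A : Set c} → List⁺ A → (A → Carrier) → Carrier
  minOver xs f = foldr₁ min (map f xs)

  maxOver : {A : Set c} → List⁺ A → (A → Carrier) → Carrier
  maxOver xs f = foldr₁ max (map f xs)

  -- Points of ℝ^d / ℝ1 are represented by vectors Fin d → Carrier.
  Point : ℕ → Set c
  Point d = Fin d → Carrier

  -- The constraints of the hard margin LP contributed by one point ξ
  -- with i(ξ) = a and j(ξ) = b, for the variable (z; ω).
  PointConstraints : {d : ℕ} → Point d → (a b : Fin d) → Carrier → Point d → Set c
  PointConstraints ξ a b z ω =
      (z + ξ b + ω b - ξ a - ω a ≤ 0#)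
    × (ω b - ω a ≤ ξ a - ξ b)
    × (∀ l → ¬ (l ≡ a) → ¬ (l ≡ b) → ω l - ω b ≤ ξ b - ξ l)

  Feasible : {d : ℕ} → List⁺ (Point d) → List⁺ (Point d) → (iP iQ j : Fin d)
           → Carrier → Point d → Set c
  Feasible P Q iP iQ j z ω =
      (∀ p → p ∈⁺ P → PointConstraints p iP j z ω)
    × (∀ q → q ∈⁺ Q → PointConstraints q iQ j z ω)

  HasFeasibleSolution : {d : ℕ} → List⁺ (Point d) → List⁺ (Point d) → (iP iQ j : Fin d) → Set c
  HasFeasibleSolution {d} P Q iP iQ j = Σ[ z ∈ Carrier ] Σ[ ω ∈ Point d ] Feasible P Q iP iQ j z ω

  IsOptimalValue : {d : ℕ} → List⁺ (Point d) → List⁺ (Point d) → (iP iQ j : Fin d) → Carrier → Set c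
  IsOptimalValue {d} P Q iP iQ j v =
      (Σ[ ω ∈ Point d ] Feasible P Q iP iQ j v ω)
    × (∀ z ω → Feasible P Q iP iQ j z ω → z ≤ v)

module Submission where

-- Normalise ω by ω j = 0.  The constraints of a point ξ with i(ξ) = a then read
-- z ≤ (ξ a - ξ j) + ω a,  - ω a ≤ ξ a - ξ j  and  ω l ≤ ξ j - ξ l (l ≠ a, j).
-- As iP ≠ iQ, each q ∈ Q caps ω iP by q j - q iP, while each p ∈ P bounds - ω iP
-- by p iP - p j; this yields the first separation condition and, through the
-- first constraint, z ≤ min P (iP - j) + min Q (j - iP); symmetrically for iQ.
-- Conversely, giving each coordinate ω l the tightest cap it receives makes all
-- constraints hold with z equal to the smaller of the two bounds.

open import Defs
open import Data.Nat using (ℕ)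
open import Data.Fin using (Fin)
open import Data.Fin.Properties using (_≟_)
open import Data.Product using (_×_; _,_; proj₁; proj₂; ∃-syntax)
open import Data.Sum using (inj₁; inj₂)
open import Data.List.NonEmpty using (List⁺; _∷_; foldr₁; map)
open import Data.List using ([]; _∷_)
open import Data.List.Relation.Unary.Any using (here; there)
open import Function using (flip; _∘_)
open import Function.Bundles using (_⇔_; mk⇔)
open import Algebra.Core using (Op₂)
open import Algebra.Definitions using (Selective)
open import Algebra.Bundles using (CommutativeRing)
open import Algebra.Construct.NaturalChoice.Base using (MinOperator; MaxOperator)
open import Relation.Nullary using (¬_; yes; no; contradiction)
open import Relation.Binary.Core using (Rel)
open import Relation.Binary.Definitions using (Reflexive; Transitive)
open import Relation.Binary.Bundles using (TotalOrder)
open import Relation.Binary.Structures using (IsTotalOrder)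
open import Relation.Binary.PropositionalEquality

module _ {a b} {A : Set a} {B : Set b} (f : A → B) {_⊙_ : Op₂ B} where

  foldr₁-map-selective : Selective _≡_ _⊙_ →
                         ∀ xs → ∃[ y ] (y ∈⁺ xs × foldr₁ _⊙_ (map f xs) ≡ f y)
  foldr₁-map-selective sel (x ∷ xs) = go x xs
    where
    go : ∀ x xs → ∃[ y ] (y ∈⁺ (x ∷ xs) × foldr₁ _⊙_ (map f (x ∷ xs)) ≡ f y)
    go x []        = x , here refl , refl
    go x (x′ ∷ xs) with sel (f x) (foldr₁ _⊙_ (map f (x′ ∷ xs))) | go x′ xs
    ... | inj₁ eq | _              = x , here refl , eq
    ... | inj₂ eq | y , y∈xs , eq′ = y , there y∈xs , trans eq eq′

  foldr₁-map-bound : ∀ {r} {R : Rel B r} → Reflexive R → Transitive R →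
                     (∀ x y → R (x ⊙ y) x) → (∀ x y → R (x ⊙ y) y) →
                     ∀ xs {y} → y ∈⁺ xs → R (foldr₁ _⊙_ (map f xs)) (f y)
  foldr₁-map-bound refl′ trans′ boundˡ boundʳ (x ∷ []) (here refl) = refl′
  foldr₁-map-bound refl′ trans′ boundˡ boundʳ (x ∷ x′ ∷ xs) (here refl) = boundˡ _ _
  foldr₁-map-bound refl′ trans′ boundˡ boundʳ (x ∷ x′ ∷ xs) (there y∈xs) =
    trans′ (boundʳ _ _) (foldr₁-map-bound refl′ trans′ boundˡ boundʳ (x′ ∷ xs) y∈xs)

module OrderedFieldProperties {c} (F : OrderedField c) where
  open OrderedField F
  open IsTotalOrder isTotalOrder using (total; antisym)
  open IsTotalOrder isTotalOrder public using () renaming (refl to ≤-refl; trans to ≤-trans)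

  commutativeRing : CommutativeRing c c
  commutativeRing = record { isCommutativeRing = isCommutativeRing }

  open CommutativeRing commutativeRing
    using (+-abelianGroup; +-commutativeMonoid; +-comm; +-identityʳ; -‿inverseʳ)
  open CommutativeRing commutativeRing public using (+-identityˡ)
  open import Algebra.Properties.AbelianGroup +-abelianGroup
    using (⁻¹-∙-comm; xyx⁻¹≈y; //-rightDividesˡ; ε⁻¹≈ε)
  open import Algebra.Properties.AbelianGroup +-abelianGroup public using (⁻¹-anti-homo‿-)
  open import Algebra.Solver.CommutativeMonoid +-commutativeMonoid using (solve; _⊕_; _⊜_)

  +-monoʳ-≤ : ∀ z {x y} → x ≤ y → z + x ≤ z + y
  +-monoʳ-≤ z {x} {y} x≤y = subst₂ _≤_ (+-comm x z) (+-comm y z) (+-mono-≤ z x≤y)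

  x≤y⇒x-y≤0 : ∀ {x y} → x ≤ y → x - y ≤ 0#
  x≤y⇒x-y≤0 {x} {y} x≤y = subst (x - y ≤_) (-‿inverseʳ y) (+-mono-≤ (- y) x≤y)

  x-y≤0⇒x≤y : ∀ {x y} → x - y ≤ 0# → x ≤ y
  x-y≤0⇒x≤y {x} {y} x-y≤0 = subst₂ _≤_ (//-rightDividesˡ y x) (+-identityˡ y) (+-mono-≤ y x-y≤0)

  neg-antimono-≤ : ∀ {x y} → x ≤ y → - y ≤ - x
  neg-antimono-≤ {x} {y} x≤y =
    subst₂ _≤_ (xyx⁻¹≈y x (- y)) (+-identityˡ (- x)) (+-mono-≤ (- x) (x≤y⇒x-y≤0 x≤y))

  x-0≡x : ∀ x → x - 0# ≡ x
  x-0≡x x = trans (cong (x +_) ε⁻¹≈ε) (+-identityʳ x)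

  x+b+y-a-z≡x-[[a-b]+[z-y]] : ∀ x a b y z → x + b + y - a - z ≡ x - ((a - b) + (z - y))
  x+b+y-a-z≡x-[[a-b]+[z-y]] x a b y z = begin
    x + b + y - a - z                  ≡⟨ regroup x b y (- a) (- z) ⟩
    x + ((b - a) + (y - z))            ≡⟨ cong (x +_) (cong₂ _+_ (sym (⁻¹-anti-homo‿- a b))
                                                                 (sym (⁻¹-anti-homo‿- z y))) ⟩
    x + (- (a - b) + - (z - y))        ≡⟨ cong (x +_) (⁻¹-∙-comm (a - b) (z - y)) ⟩
    x - ((a - b) + (z - y))            ∎
    where
    open ≡-Reasoning
    regroup : ∀ x b y a′ z′ → x + b + y + a′ + z′ ≡ x + ((b + a′) + (y + z′))
    regroup = solve 5 (λ x b y a′ z′ → (((x ⊕ b) ⊕ y) ⊕ a′) ⊕ z′ ⊜ x ⊕ ((b ⊕ a′) ⊕ (y ⊕ z′))) refl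

  totalOrder : TotalOrder c c c
  totalOrder = record { isTotalOrder = isTotalOrder }

  minOperator : MinOperator (TotalOrder.totalPreorder totalOrder)
  minOperator = record { _⊓_ = min ; x≤y⇒x⊓y≈x = x≤y⇒min≡x ; x≥y⇒x⊓y≈y = y≤x⇒min≡y }
    where
    x≤y⇒min≡x : ∀ {x y} → x ≤ y → min x y ≡ x
    x≤y⇒min≡x {x} {y} x≤y with total x y
    ... | inj₁ _   = refl
    ... | inj₂ y≤x = antisym y≤x x≤y
    y≤x⇒min≡y : ∀ {x y} → y ≤ x → min x y ≡ y
    y≤x⇒min≡y {x} {y} y≤x with total x y
    ... | inj₁ x≤y = antisym x≤y y≤x
    ... | inj₂ _   = refl

  maxOperator : MaxOperator (TotalOrder.totalPreorder totalOrder)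
  maxOperator = record { _⊔_ = max ; x≤y⇒x⊔y≈y = x≤y⇒max≡y ; x≥y⇒x⊔y≈x = y≤x⇒max≡x }
    where
    x≤y⇒max≡y : ∀ {x y} → x ≤ y → max x y ≡ y
    x≤y⇒max≡y {x} {y} x≤y with total x y
    ... | inj₁ _   = refl
    ... | inj₂ y≤x = antisym x≤y y≤x
    y≤x⇒max≡x : ∀ {x y} → y ≤ x → max x y ≡ x
    y≤x⇒max≡x {x} {y} y≤x with total x y
    ... | inj₁ x≤y = antisym y≤x x≤y
    ... | inj₂ _   = refl

  open import Algebra.Construct.NaturalChoice.MinOp minOperator using (⊓-sel)
  open import Algebra.Construct.NaturalChoice.MinOp minOperator public using (x⊓y≤x; x⊓y≤y; ⊓-glb)
  open import Algebra.Construct.NaturalChoice.MaxOp maxOperator using (x≤x⊔y; x≤y⊔x; ⊔-sel)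

  module _ {A : Set c} (xs : List⁺ A) (f : A → Carrier) where

    minOver-attained : ∃[ y ] (y ∈⁺ xs × minOver xs f ≡ f y)
    minOver-attained = foldr₁-map-selective f ⊓-sel xs

    maxOver-attained : ∃[ y ] (y ∈⁺ xs × maxOver xs f ≡ f y)
    maxOver-attained = foldr₁-map-selective f ⊔-sel xs

    minOver-≤ : ∀ {y} → y ∈⁺ xs → minOver xs f ≤ f y
    minOver-≤ = foldr₁-map-bound f ≤-refl ≤-trans x⊓y≤x x⊓y≤y xs

    ≤-maxOver : ∀ {y} → y ∈⁺ xs → f y ≤ maxOver xs f
    ≤-maxOver = foldr₁-map-bound f {R = flip _≤_} ≤-refl (flip ≤-trans) x≤x⊔y x≤y⊔x xs

  module _ {A B : Set c} (xs : List⁺ A) (ys : List⁺ B) {f : A → Carrier} {g : B → Carrier} where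

    maxOver≤minOver : (∀ {x y} → x ∈⁺ xs → y ∈⁺ ys → f x ≤ g y) → maxOver xs f ≤ minOver ys g
    maxOver≤minOver f≤g
      with maxOver-attained xs f | minOver-attained ys g
    ... | x , x∈xs , max≡fx | y , y∈ys , min≡gy = subst₂ _≤_ (sym max≡fx) (sym min≡gy) (f≤g x∈xs y∈ys)

    ≤-minOver+minOver : ∀ {z} → (∀ {x y} → x ∈⁺ xs → y ∈⁺ ys → z ≤ f x + g y) →
                        z ≤ minOver xs f + minOver ys g
    ≤-minOver+minOver z≤f+g
      with minOver-attained xs f | minOver-attained ys g
    ... | x , x∈xs , minf≡fx | y , y∈ys , ming≡gy =
      subst (_ ≤_) (sym (cong₂ _+_ minf≡fx ming≡gy)) (z≤f+g x∈xs y∈ys)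

module HardMargin {c} (F : OrderedField c) {d : ℕ} where
  open OrderedField F
  open OrderedFieldProperties F

  δ : Fin d → Fin d → Point d → Carrier
  δ a b ξ = ξ a - ξ b

  neg-minOver-δ : ∀ (xs : List⁺ (Point d)) {a b} → - minOver xs (δ b a) ≤ maxOver xs (δ a b)
  neg-minOver-δ xs {a} {b} with minOver-attained xs (δ b a)
  ... | ξ , ξ∈xs , min≡ =
    subst₂ _≤_ (trans (sym (⁻¹-anti-homo‿- (ξ b) (ξ a))) (cong -_ (sym min≡))) refl (≤-maxOver xs (δ a b) ξ∈xs)

  module _ {ξ ω : Point d} {a b : Fin d} {z : Carrier} where

    PointConstraints⇒margin : PointConstraints ξ a b z ω → z ≤ δ a b ξ + δ a b ω
    PointConstraints⇒margin (margin , _ , _) =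
      x-y≤0⇒x≤y (subst (_≤ 0#) (x+b+y-a-z≡x-[[a-b]+[z-y]] z (ξ a) (ξ b) (ω b) (ω a)) margin)

    bounds⇒PointConstraints : ω b ≡ 0# → z ≤ δ a b ξ + ω a → - ω a ≤ δ a b ξ →
                              (∀ l → ¬ l ≡ a → ¬ l ≡ b → ω l ≤ δ b l ξ) →
                              PointConstraints ξ a b z ω
    bounds⇒PointConstraints ωb≡0 margin lower upper =
        subst (_≤ 0#) (sym (x+b+y-a-z≡x-[[a-b]+[z-y]] z (ξ a) (ξ b) (ω b) (ω a)))
          (x≤y⇒x-y≤0 (subst (λ t → z ≤ δ a b ξ + t) (sym (x-ωb≡x (ω a))) margin))
      , subst (_≤ δ a b ξ) (sym (trans (cong (_- ω a) ωb≡0) (+-identityˡ (- ω a)))) lower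
      , λ l l≢a l≢b → subst (_≤ δ b l ξ) (sym (x-ωb≡x (ω l))) (upper l l≢a l≢b)
      where
      x-ωb≡x : ∀ x → x - ω b ≡ x
      x-ωb≡x x = trans (cong (λ t → x - t) ωb≡0) (x-0≡x x)

  module _ {ξ η ω : Point d} {a a′ b : Fin d} {z : Carrier}
           (a≢a′ : ¬ a ≡ a′) (a≢b : ¬ a ≡ b)
           (ξ-ok : PointConstraints ξ a b z ω) (η-ok : PointConstraints η a′ b z ω) where

    private
      ω-gap≤η-gap : δ a b ω ≤ δ b a η
      ω-gap≤η-gap = proj₂ (proj₂ η-ok) a a≢a′ a≢b

    pair⇒margin-bound : z ≤ δ a b ξ + δ b a η
    pair⇒margin-bound = ≤-trans (PointConstraints⇒margin ξ-ok) (+-monoʳ-≤ (δ a b ξ) ω-gap≤η-gap)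

    pair⇒separation : δ a b η ≤ δ a b ξ
    pair⇒separation = ≤-trans
      (subst₂ _≤_ (⁻¹-anti-homo‿- (η b) (η a)) (⁻¹-anti-homo‿- (ω a) (ω b)) (neg-antimono-≤ ω-gap≤η-gap))
      (proj₁ (proj₂ ξ-ok))

  minOver-bounds⇒PointConstraints : ∀ (R : List⁺ (Point d)) {a b z ω} → ω b ≡ 0# →
                                    z ≤ minOver R (δ a b) + ω a → - ω a ≤ minOver R (δ a b) →
                                    (∀ l → ¬ l ≡ a → ¬ l ≡ b → ∀ {ξ} → ξ ∈⁺ R → ω l ≤ δ b l ξ) →
                                    ∀ ξ → ξ ∈⁺ R → PointConstraints ξ a b z ω
  minOver-bounds⇒PointConstraints R {a} {b} {z} {ω} ωb≡0 margin lower upper ξ ξ∈R =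
    bounds⇒PointConstraints ωb≡0
      (≤-trans margin (+-mono-≤ (ω a) (minOver-≤ R (δ a b) ξ∈R)))
      (≤-trans lower (minOver-≤ R (δ a b) ξ∈R))
      (λ l l≢a l≢b → upper l l≢a l≢b ξ∈R)

  module TwoClasses (P Q : List⁺ (Point d)) (iP iQ j : Fin d)
                    (iP≢iQ : ¬ iP ≡ iQ) (iP≢j : ¬ iP ≡ j) (iQ≢j : ¬ iQ ≡ j) where

    Separated : Set c
    Separated = (maxOver Q (δ iP j) ≤ minOver P (δ iP j)) × (maxOver P (δ iQ j) ≤ minOver Q (δ iQ j))

    optimum : Carrier
    optimum = min (minOver P (δ iP j) + minOver Q (δ j iP)) (minOver Q (δ iQ j) + minOver P (δ j iQ))

    iQ≢iP : ¬ iQ ≡ iP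
    iQ≢iP = iP≢iQ ∘ sym

    feasible⇒separated : ∀ {z ω} → Feasible P Q iP iQ j z ω → Separated
    feasible⇒separated (P-ok , Q-ok) =
        maxOver≤minOver Q P (λ q∈Q p∈P → pair⇒separation iP≢iQ iP≢j (P-ok _ p∈P) (Q-ok _ q∈Q))
      , maxOver≤minOver P Q (λ p∈P q∈Q → pair⇒separation iQ≢iP iQ≢j (Q-ok _ q∈Q) (P-ok _ p∈P))

    feasible⇒≤optimum : ∀ {z ω} → Feasible P Q iP iQ j z ω → z ≤ optimum
    feasible⇒≤optimum (P-ok , Q-ok) = ⊓-glb
      (≤-minOver+minOver P Q (λ p∈P q∈Q → pair⇒margin-bound iP≢iQ iP≢j (P-ok _ p∈P) (Q-ok _ q∈Q)))
      (≤-minOver+minOver Q P (λ q∈Q p∈P → pair⇒margin-bound iQ≢iP iQ≢j (Q-ok _ q∈Q) (P-ok _ p∈P)))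

    ω* : Point d
    ω* l with l ≟ j | l ≟ iP | l ≟ iQ
    ... | yes _ | _     | _     = 0#
    ... | no _  | yes _ | _     = minOver Q (δ j iP)
    ... | no _  | no _  | yes _ = minOver P (δ j iQ)
    ... | no _  | no _  | no _  = min (minOver P (δ j l)) (minOver Q (δ j l))

    ω*-j : ω* j ≡ 0#
    ω*-j with j ≟ j
    ... | yes _   = refl
    ... | no j≢j = contradiction refl j≢j

    ω*-iP : ω* iP ≡ minOver Q (δ j iP)
    ω*-iP with iP ≟ j | iP ≟ iP
    ... | yes iP≡j | _         = contradiction iP≡j iP≢j
    ... | no _     | yes _     = refl
    ... | no _     | no iP≢iP = contradiction refl iP≢iP

    ω*-iQ : ω* iQ ≡ minOver P (δ j iQ)
    ω*-iQ with iQ ≟ j | iQ ≟ iP | iQ ≟ iQ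
    ... | yes iQ≡j | _         | _         = contradiction iQ≡j iQ≢j
    ... | no _     | yes iQ≡iP | _         = contradiction iQ≡iP iQ≢iP
    ... | no _     | no _      | yes _     = refl
    ... | no _     | no _      | no iQ≢iQ = contradiction refl iQ≢iQ

    ω*-bound-P : ∀ l → ¬ l ≡ iP → ¬ l ≡ j → ∀ {p} → p ∈⁺ P → ω* l ≤ δ j l p
    ω*-bound-P l l≢iP l≢j p∈P with l ≟ j | l ≟ iP | l ≟ iQ
    ... | yes l≡j | _        | _        = contradiction l≡j l≢j
    ... | no _    | yes l≡iP | _        = contradiction l≡iP l≢iP
    ... | no _    | no _     | yes refl = minOver-≤ P (δ j iQ) p∈P
    ... | no _    | no _     | no _     = ≤-trans (x⊓y≤x _ _) (minOver-≤ P (δ j l) p∈P)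

    ω*-bound-Q : ∀ l → ¬ l ≡ iQ → ¬ l ≡ j → ∀ {q} → q ∈⁺ Q → ω* l ≤ δ j l q
    ω*-bound-Q l l≢iQ l≢j q∈Q with l ≟ j | l ≟ iP | l ≟ iQ
    ... | yes l≡j | _        | _        = contradiction l≡j l≢j
    ... | no _    | yes refl | _        = minOver-≤ Q (δ j iP) q∈Q
    ... | no _    | no _     | yes l≡iQ = contradiction l≡iQ l≢iQ
    ... | no _    | no _     | no _     = ≤-trans (x⊓y≤y _ _) (minOver-≤ Q (δ j l) q∈Q)

    separated⇒feasible : Separated → Feasible P Q iP iQ j optimum ω*
    separated⇒feasible (Q≤P , P≤Q) =
        minOver-bounds⇒PointConstraints P ω*-j
          (subst (λ t → optimum ≤ _ + t) (sym ω*-iP) (x⊓y≤x _ _))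
          (subst (λ t → - t ≤ _) (sym ω*-iP) (≤-trans (neg-minOver-δ Q) Q≤P))
          ω*-bound-P
      , minOver-bounds⇒PointConstraints Q ω*-j
          (subst (λ t → optimum ≤ _ + t) (sym ω*-iQ) (x⊓y≤y _ _))
          (subst (λ t → - t ≤ _) (sym ω*-iQ) (≤-trans (neg-minOver-δ P) P≤Q))
          ω*-bound-Q

theorem7 : ∀ {c} (F : OrderedField c) → let open OrderedField F in
    (d : ℕ) (P Q : List⁺ (Point d)) (iP iQ j : Fin d) →
    ¬ (iP ≡ iQ) → ¬ (iP ≡ j) → ¬ (iQ ≡ j) →
      (HasFeasibleSolution P Q iP iQ j
        ⇔ ((maxOver Q (λ q → q iP - q j) ≤ minOver P (λ p → p iP - p j))
           × (maxOver P (λ p → p iQ - p j) ≤ minOver Q (λ q → q iQ - q j))))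
    × (HasFeasibleSolution P Q iP iQ j →
        IsOptimalValue P Q iP iQ j
          (min (minOver P (λ p → p iP - p j) + minOver Q (λ q → q j - q iP))
               (minOver Q (λ q → q iQ - q j) + minOver P (λ p → p j - p iQ))))
theorem7 F d P Q iP iQ j iP≢iQ iP≢j iQ≢j =
    mk⇔ (λ (_ , _ , feasible) → feasible⇒separated feasible)
        (λ separated → optimum , ω* , separated⇒feasible separated)
  , λ (_ , _ , feasible) →
      (ω* , separated⇒feasible (feasible⇒separated feasible)) , λ _ _ → feasible⇒≤optimum
  where open HardMargin.TwoClasses F P Q iP iQ j iP≢iQ iP≢j iQ≢j
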